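{- Let $\mathcal{G}$ be a concurrent game structure with imperfect information, $v,v'$ positions, and $\rho,\rho'$ finite (possibly empty) sequences of positions such that $v\cdot\rho\cdot v'\cdot\rho'$ is a finite play. If $v\cdot\rho\cdot v'\cdot\rho'$ yields hierarchical information in $(\mathcal{G},v)$ with preorder $\preceq$, then $v'\cdot\rho'$ yields hierarchical information in $(\mathcal{G},v')$ with the same preorder $\preceq$.
   Context: A CGS is $\mathcal{G}=(V,\delta,\ell,\{\sim_a\}_{a\in Ag})$ with positions $V$, transitions $\delta$ (function $V\times Mov^{Ag}\to V$, or relation for nondeterministic CGS), labelling $\ell$, and an equivalence relation $\sim_a$ on $V$ per agent. $\mathrm{FPlay}(\mathcal{G},u)$ is the set of finite plays (sequences of positions with consecutive positions linked by a joint move) starting in $u$. Finite plays $\rho_1\sim_a\rho_2$ iff they have equal length and are positionwise $\sim_a$-related. For $\tau\in\mathrm{FPlay}(\mathcal{G},u)$, the information set of $a$ in $(\mathcal{G},u)$ is $I_a(\tau)=\{\tau'\in\mathrm{FPlay}(\mathcal{G},u)\mid\tau\sim_a\tau'\}$. $\tau$ yields hierarchical information in $(\mathcal{G},u)$ with total preorder $\preceq$ on $Ag$ if $a\preceq b$ implies $I_a(\tau)\subseteq I_b(\tau)$. -}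

module Defs where

import Agda.Primitive
open import Data.List using (List; []; _∷_)
open import Data.Unit using (⊤)
import Data.Empty
open import Data.Product using (Σ; _×_; _,_)
open import Relation.Binary.Structures using (IsEquivalence)
open import Relation.Binary.PropositionalEquality using (_≡_)
open import Relation.Unary using (Pred; _⊆_)
open import Data.List.Relation.Binary.Pointwise using (Pointwise)

record CGS (Ag Mov AP : Set) : Set₁ where
  field
    V       : Set
    δ       : V → (Ag → Mov) → V
    ℓ       : V → Pred AP Agda.Primitive.lzero
    _∼[_]_  : V → Ag → V → Set
    ∼-equiv : (a : Ag) → IsEquivalence (λ x y → x ∼[ a ] y)

module _ {Ag Mov AP : Set} (G : CGS Ag Mov AP) where
  open CGS G

  Linked : List V → Set
  Linked []          = ⊤
  Linked (x ∷ [])    = ⊤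
  Linked (x ∷ y ∷ τ) = Σ (Ag → Mov) (λ m → δ x m ≡ y) × Linked (y ∷ τ)

  FPlay : V → Pred (List V) Agda.Primitive.lzero
  FPlay u []      = Data.Empty.⊥
  FPlay u (x ∷ τ) = (x ≡ u) × Linked (x ∷ τ)

  _≈[_]_ : List V → Ag → List V → Set
  ρ₁ ≈[ a ] ρ₂ = Pointwise (λ x y → x ∼[ a ] y) ρ₁ ρ₂

  InfoSet : Ag → V → List V → Pred (List V) Agda.Primitive.lzero
  InfoSet a u τ τ' = FPlay u τ' × (τ ≈[ a ] τ')

  YieldsHierarchical : V → (Ag → Ag → Set) → List V → Set
  YieldsHierarchical u _⪯_ τ = ∀ {a b} → a ⪯ b → InfoSet a u τ ⊆ InfoSet b u τ

module Submission where

-- Write h = v · ρ for the history preceding v' in the play v · ρ · v' · ρ'.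
-- Prefixing by h maps plays from v' to plays from v: a play v' · τ can be
-- spliced after h because h · v' · ρ' is a play ending its prefix in v'
-- (`Linked-splice`, `FPlay-splice`).  Prefixing by the common history h also
-- preserves and reflects indistinguishability, by reflexivity of ∼_a and
-- pointwise cancellation of a common prefix (library lemmas `++⁺ˡ`,
-- `++-cancelˡ`).  Hence h ++_ embeds the information set of agent a at
-- v' · ρ' into the one at h · v' · ρ' (`InfoSet-prefix`), and the latter
-- restricts back (`InfoSet-unprefix`).  For a ⪯ b, an element of I_a(v'·ρ')
-- is thus sent into I_a(h·v'·ρ') ⊆ I_b(h·v'·ρ') and pulled back into
-- I_b(v'·ρ').  The argument uses no property of ⪯.

open import Defs
open import Data.List using (List; []; _∷_; _++_)
open import Data.Product using (_,_)
open import Relation.Binary.PropositionalEquality using (_≡_; refl)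
open import Relation.Binary.Structures using (IsTotalPreorder; IsEquivalence)
open import Data.List.Relation.Binary.Pointwise using (++⁺ˡ; ++-cancelˡ)

module _ {Ag Mov AP : Set} (G : CGS Ag Mov AP) where
  open CGS G

  Linked-splice : (u x : V) (π τ τ' : List V)
                → Linked G (u ∷ π ++ x ∷ τ) → Linked G (x ∷ τ')
                → Linked G (u ∷ π ++ x ∷ τ')
  Linked-splice u x []      τ τ' (m , _) l' = m , l'
  Linked-splice u x (y ∷ π) τ τ' (m , l) l' = m , Linked-splice y x π τ τ' l l'

  FPlay-splice : (u x : V) (π τ τ' : List V)
               → FPlay G u (u ∷ π ++ x ∷ τ) → FPlay G x τ'
               → FPlay G u (u ∷ π ++ τ')
  FPlay-splice u x π τ (.x ∷ τ') (_ , l) (refl , l') =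
    refl , Linked-splice u x π τ τ' l l'

  InfoSet-prefix : (a : Ag) (u x : V) (π τ τ' : List V)
                 → FPlay G u (u ∷ π ++ x ∷ τ)
                 → InfoSet G a x (x ∷ τ) τ'
                 → InfoSet G a u (u ∷ π ++ x ∷ τ) (u ∷ π ++ τ')
  InfoSet-prefix a u x π τ τ' play (play' , τ≈τ') =
    FPlay-splice u x π τ τ' play play' ,
    ++⁺ˡ (IsEquivalence.refl (∼-equiv a)) (u ∷ π) τ≈τ'

  InfoSet-unprefix : (b : Ag) (u x : V) (π τ τ' : List V)
                   → FPlay G x τ'
                   → InfoSet G b u (u ∷ π ++ x ∷ τ) (u ∷ π ++ τ')
                   → InfoSet G b x (x ∷ τ) τ'
  InfoSet-unprefix b u x π τ τ' play' (_ , hτ≈hτ') =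
    play' , ++-cancelˡ (u ∷ π) hτ≈hτ'

lemma1 : {Ag Mov AP : Set} (G : CGS Ag Mov AP) (_⪯_ : Ag → Ag → Set)
         → IsTotalPreorder _≡_ _⪯_
         → (v v' : CGS.V G) (ρ ρ' : List (CGS.V G))
         → FPlay G v (v ∷ ρ ++ v' ∷ ρ')
         → YieldsHierarchical G v _⪯_ (v ∷ ρ ++ v' ∷ ρ')
         → YieldsHierarchical G v' _⪯_ (v' ∷ ρ')
lemma1 G _⪯_ _ v v' ρ ρ' play hierarchical {a} {b} a⪯b {τ'} τ'∈Iₐ@(play' , _) =
  InfoSet-unprefix G b v v' ρ ρ' τ' play'
    (hierarchical a⪯b (InfoSet-prefix G a v v' ρ ρ' τ' play τ'∈Iₐ))
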